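{- Let $I_1:=(l_1\approx r_1\cdot\sigma_1,\ (l_1\approx r_1\lor C_1)\cdot\sigma_1,\ R_1,\ L_1,\ p_1)$ and $I_2:=(l_2\# r_2\cdot\sigma_2,\ (l_2\# r_2\lor C_2)\cdot\sigma_2,\ R_2,\ L_2,\ p_2)$ be two variable disjoint rewrite steps with $r_1\sigma_1\prec_T l_1\sigma_1$ and $((l_2\# r_2)\sigma_2)|_p=l_1\sigma_1$ for some position $p$. Let $I_3:=(l_3\# r_3\cdot\sigma_3,\ (l_3\# r_3\lor C_3)\cdot\sigma_3,\ I_1,\ I_2,\ p)$ be the result of a rewrite inference from $I_1$ and $I_2$. Then: (1) $C_3\sigma_3=(C_1\lor C_2)\sigma_1\sigma_2$ and $(l_3\# r_3)\sigma_3=((l_2\# r_2)\sigma_2)[r_1\sigma_1]_p$; (2) $(l_3\# r_3)\sigma_3\prec_T(l_2\# r_2)\sigma_2$; (3) if $N\models(l_1\approx r_1\lor C_1)\land(l_2\# r_2\lor C_2)$ for some set of clauses $N$, then $N\models l_3\# r_3\lor C_3$.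
   Context: First-order logic with equality as only predicate; $s\# t$ denotes either $s\approx t$ or $s\not\approx t$; clauses are disjunctions (multisets) of such literals. $\prec_T$ is a desired term ordering: a well-founded rewrite ordering on terms, total on ground terms, with only finitely many ground terms below any ground term; it is extended to literals by assigning $\{s,t\}$ to $s\approx t$ and $\{s,s,t,t\}$ to $s\not\approx t$ and comparing via the multiset extension. $L|_p$ is the subterm of literal $L$ at position $p\in\mathrm{pos}(L)$ and $L[s]_p$ the result of replacing it by $s$. A closure $C\cdot\sigma$ is a clause (or literal) $C$ together with a grounding substitution $\sigma$. Most general unifiers (mgu) are idempotent and introduce no fresh variables. Rewrite step: a five-tuple $(s\# t\cdot\sigma,\ (s\# t\lor C)\cdot\sigma,\ R,\ S,\ p)$; $(s\# t\cdot\sigma,(s\# t\lor C)\cdot\sigma,\epsilon,\epsilon,\epsilon)$ is a rewrite step, and given rewrite steps $R,S$ and a position $p$, $(s\# t\cdot\sigma,(s\# t\lor C)\cdot\sigma,R,S,p)$ is a rewrite step. $s\# t$ is its rewrite literal. Rewrite inference: let $I_1,I_2$ be as in the claim (variable disjoint, $r_1\sigma_1\prec_T l_1\sigma_1$, $((l_2\# r_2)\sigma_2)|_p=l_1\sigma_1$). Two cases: (a) if $p\in\mathrm{pos}(l_2\# r_2)$ and $\mu:=\mathrm{mgu}((l_2\# r_2)|_p,l_1)$, then $\big(((l_2\# r_2)[r_1]_p)\mu\cdot\sigma_1\sigma_2,\ (((l_2\# r_2)[r_1]_p)\mu\lor C_1\mu\lor C_2\mu)\cdot\sigma_1\sigma_2,\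 I_1,\ I_2,\ p\big)$ is the result of a rewrite inference; (b) if $p\notin\mathrm{pos}(l_2\# r_2)$, let $(l_2\# r_2)\delta$ be the most general instance of $l_2\# r_2$ such that $p\in\mathrm{pos}((l_2\# r_2)\delta)$, where $\delta$ introduces only fresh variables and $(l_2\# r_2)\delta\sigma_2\rho=(l_2\# r_2)\sigma_2$ for some minimal $\rho$; let $\mu:=\mathrm{mgu}(((l_2\# r_2)\delta)|_p,l_1)$. Then $\big(((l_2\# r_2)\delta[r_1]_p)\mu\cdot\sigma_1\sigma_2\rho,\ (((l_2\# r_2)\delta[r_1]_p)\mu\lor C_1\mu\lor C_2\delta\mu)\cdot\sigma_1\sigma_2\rho,\ I_1,\ I_2,\ p\big)$ is the result of a rewrite inference. -}

module Defs where

open import Level using (Level)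
open import Data.Nat using (ℕ; zero; suc)
open import Data.Unit using (⊤)
open import Data.Maybe using (Maybe; just; nothing)
open import Data.List using (List; []; _∷_; _++_; concatMap)
open import Data.Vec using (Vec; []; _∷_)
open import Data.List.Membership.Propositional using (_∈_; _∉_)
open import Data.List.Relation.Unary.Any using (Any)
open import Data.List.Relation.Unary.All using (All)
open import Data.List.Relation.Binary.Permutation.Propositional using (_↭_)
open import Data.Product using (Σ; ∃; _×_; _,_)
open import Data.Sum using (_⊎_)
open import Relation.Binary.PropositionalEquality using (_≡_; _≢_)
open import Relation.Nullary using (¬_)
open import Induction.WellFounded using (WellFounded)

module FOL (Fun : Set) (arity : Fun → ℕ) where

  data Term : Set where
    var : ℕ → Term
    fun : (f : Fun) → Vec Term (arity f) → Term

  Subst : Set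
  Subst = ℕ → Term

  dom : Subst → ℕ → Set
  dom σ x = σ x ≢ var x

  mutual
    _⟨_⟩ : Term → Subst → Term
    var x ⟨ σ ⟩ = σ x
    fun f ts ⟨ σ ⟩ = fun f (ts ⟨ σ ⟩*)

    _⟨_⟩* : ∀ {n} → Vec Term n → Subst → Vec Term n
    [] ⟨ σ ⟩* = []
    (t ∷ ts) ⟨ σ ⟩* = (t ⟨ σ ⟩) ∷ (ts ⟨ σ ⟩*)

  -- composition: σ ⊙ τ  means "first σ, then τ"  (x (σ ⊙ τ) = (x σ) τ)
  _⊙_ : Subst → Subst → Subst
  (σ ⊙ τ) x = (σ x) ⟨ τ ⟩

  mutual
    varsT : Term → List ℕ
    varsT (var x) = x ∷ []
    varsT (fun f ts) = varsT* ts

    varsT* : ∀ {n} → Vec Term n → List ℕ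
    varsT* [] = []
    varsT* (t ∷ ts) = varsT t ++ varsT* ts

  Ground : Term → Set
  Ground t = varsT t ≡ []

  -- term positions: lists of argument indices (0-based)
  Pos : Set
  Pos = List ℕ

  mutual
    subterm : Term → Pos → Maybe Term
    subterm t [] = just t
    subterm (var x) (i ∷ p) = nothing
    subterm (fun f ts) (i ∷ p) = subterm* ts i p

    subterm* : ∀ {n} → Vec Term n → ℕ → Pos → Maybe Term
    subterm* [] i p = nothing
    subterm* (t ∷ ts) zero p = subterm t p
    subterm* (t ∷ ts) (suc i) p = subterm* ts i p

  mutual
    -- t[s]_p  (t unchanged if p ∉ pos(t))
    replace : Term → Pos → Term → Term
    replace t [] s = s
    replace (var x) (i ∷ p) s = var x
    replace (fun f ts) (i ∷ p) s = fun f (replace* ts i p s)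

    replace* : ∀ {n} → Vec Term n → ℕ → Pos → Term → Vec Term n
    replace* [] i p s = []
    replace* (t ∷ ts) zero p s = replace t p s ∷ ts
    replace* (t ∷ ts) (suc i) p s = t ∷ replace* ts i p s

  data Sign : Set where
    ≈ ≉ : Sign

  data Lit : Set where
    lit : Sign → Term → Term → Lit

  Clause : Set
  Clause = List Lit   -- a clause is the disjunction of its literals

  _⟪_⟫ : Lit → Subst → Lit
  lit b s t ⟪ σ ⟫ = lit b (s ⟨ σ ⟩) (t ⟨ σ ⟩)

  _⟪_⟫c : Clause → Subst → Clause
  [] ⟪ σ ⟫c = []
  (L ∷ C) ⟪ σ ⟫c = (L ⟪ σ ⟫) ∷ (C ⟪ σ ⟫c)

  varsL : Lit → List ℕ
  varsL (lit b s t) = varsT s ++ varsT t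

  varsC : Clause → List ℕ
  varsC = concatMap varsL

  -- literal positions: 0 ∷ p is position p in the left term, 1 ∷ p in the right
  litAt : Lit → Pos → Maybe Term
  litAt (lit b s t) (0 ∷ p) = subterm s p
  litAt (lit b s t) (1 ∷ p) = subterm t p
  litAt L _ = nothing

  litReplace : Lit → Pos → Term → Lit
  litReplace (lit b s t) (0 ∷ p) u = lit b (replace s p u) t
  litReplace (lit b s t) (1 ∷ p) u = lit b s (replace t p u)
  litReplace L _ u = L

  _∈pos_ : Pos → Lit → Set
  p ∈pos L = ∃ λ u → litAt L p ≡ just u

  -- Dershowitz–Manna multiset extension of a relation, multisets as lists
  MulExt : (Term → Term → Set) → List Term → List Term → Set
  MulExt _<_ M N =
    Σ (List Term) λ Z → Σ (List Term) λ X → Σ (List Term) λ Y →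
      (X ≢ []) × (N ↭ (Z ++ X)) × (M ↭ (Z ++ Y)) ×
      All (λ y → Any (λ x → y < x) X) Y

  litMS : Lit → List Term
  litMS (lit ≈ s t) = s ∷ t ∷ []
  litMS (lit ≉ s t) = s ∷ s ∷ t ∷ t ∷ []

  record DesiredOrdering : Set₁ where
    field
      _≺_      : Term → Term → Set
      irrefl   : ∀ t → ¬ (t ≺ t)
      trans    : ∀ {s t u} → s ≺ t → t ≺ u → s ≺ u
      wf       : WellFounded _≺_
      ctx      : ∀ {s t} u p → (∃ λ v → subterm u p ≡ just v) →
                 s ≺ t → replace u p s ≺ replace u p t
      stable   : ∀ {s t} σ → s ≺ t → (s ⟨ σ ⟩) ≺ (t ⟨ σ ⟩)
      total    : ∀ s t → Ground s → Ground t → (s ≺ t) ⊎ (s ≡ t) ⊎ (t ≺ s)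
      finBelow : ∀ t → Ground t →
                 ∃ λ ts → ∀ s → Ground s → s ≺ t → s ∈ ts

    _≺L_ : Lit → Lit → Set
    L ≺L K = MulExt _≺_ (litMS L) (litMS K)

  Grounds : Subst → Clause → Set
  Grounds σ C = ∀ x → x ∈ varsC C → Ground (σ x)

  mutual
    -- mk L C σ sub  represents  (L·σ, (L ∨ C)·σ, R, S, p)
    data Step : Set where
      mk : Lit → Clause → Subst → Sub → Step

    data Sub : Set where
      ε   : Sub
      sub : Step → Step → Pos → Sub

  mutual
    WF : Step → Set
    WF (mk L C σ s) = Grounds σ (L ∷ C) × WFSub s

    WFSub : Sub → Set
    WFSub ε = ⊤
    WFSub (sub R S p) = WF R × WF S

  InStep : Step → ℕ → Set
  InStep (mk L C σ s) y = (y ∈ varsC (L ∷ C)) ⊎ dom σ y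

  VarDisjoint : Step → Step → Set
  VarDisjoint I J = ∀ y → InStep I y → ¬ InStep J y

  record IsMGU (μ : Subst) (s t : Term) : Set where
    field
      unifies    : s ⟨ μ ⟩ ≡ t ⟨ μ ⟩
      general    : ∀ θ → s ⟨ θ ⟩ ≡ t ⟨ θ ⟩ → ∃ λ η → ∀ x → θ x ≡ (μ x) ⟨ η ⟩
      idempotent : ∀ x → (μ x) ⟨ μ ⟩ ≡ μ x
      noFresh    : ∀ x y → dom μ x → y ∈ varsT (μ x) →
                   (y ∈ varsT s) ⊎ (y ∈ varsT t)

  -- case (b): (L)δ is the most general instance of L with p ∈ pos(Lδ),
  -- δ introduces only variables satisfying Fresh, and Lδσ₂ρ = Lσ₂ with ρ minimal
  record MGInst (Fresh : ℕ → Set) (L : Lit) (p : Pos) (σ₂ δ ρ : Subst) : Set where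
    field
      domδ        : ∀ x → dom δ x → x ∈ varsL L
      freshδ      : ∀ x y → dom δ x → y ∈ varsT (δ x) → Fresh y
      hasPos      : p ∈pos (L ⟪ δ ⟫)
      inst        : ((L ⟪ δ ⟫) ⟪ σ₂ ⟫) ⟪ ρ ⟫ ≡ L ⟪ σ₂ ⟫
      mostGeneral : ∀ θ → p ∈pos (L ⟪ θ ⟫) →
                    (∃ λ τ → (L ⟪ θ ⟫) ⟪ τ ⟫ ≡ L ⟪ σ₂ ⟫) →
                    ∃ λ η → (L ⟪ δ ⟫) ⟪ η ⟫ ≡ L ⟪ θ ⟫
      minimalρ    : ∀ ρ′ → ((L ⟪ δ ⟫) ⟪ σ₂ ⟫) ⟪ ρ′ ⟫ ≡ L ⟪ σ₂ ⟫ →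
                    (∀ y → dom ρ′ y → dom ρ y) → ∀ y → dom ρ y → dom ρ′ y

  FreshFor : Step → Step → ℕ → Set
  FreshFor I J y = ¬ InStep I y × ¬ InStep J y

  data RewriteInference : Step → Step → Pos → Step → Set where
    caseA : ∀ {l₁ r₁ C₁ σ₁ t₁ L₂ C₂ σ₂ t₂ p μ u} →
      let I₁ = mk (lit ≈ l₁ r₁) C₁ σ₁ t₁
          I₂ = mk L₂ C₂ σ₂ t₂ in
      litAt L₂ p ≡ just u →
      IsMGU μ u l₁ →
      RewriteInference I₁ I₂ p
        (mk ((litReplace L₂ p r₁) ⟪ μ ⟫) ((C₁ ⟪ μ ⟫c) ++ (C₂ ⟪ μ ⟫c))
            (σ₁ ⊙ σ₂) (sub I₁ I₂ p))
    caseB : ∀ {l₁ r₁ C₁ σ₁ t₁ L₂ C₂ σ₂ t₂ p δ ρ μ u} →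
      let I₁ = mk (lit ≈ l₁ r₁) C₁ σ₁ t₁
          I₂ = mk L₂ C₂ σ₂ t₂ in
      litAt L₂ p ≡ nothing →
      MGInst (FreshFor I₁ I₂) L₂ p σ₂ δ ρ →
      litAt (L₂ ⟪ δ ⟫) p ≡ just u →
      IsMGU μ u l₁ →
      RewriteInference I₁ I₂ p
        (mk ((litReplace (L₂ ⟪ δ ⟫) p r₁) ⟪ μ ⟫)
            ((C₁ ⟪ μ ⟫c) ++ ((C₂ ⟪ δ ⟫c) ⟪ μ ⟫c))
            ((σ₁ ⊙ σ₂) ⊙ ρ) (sub I₁ I₂ p))

  -- semantics (equality interpreted as identity in a nonempty domain)

  record Interp : Set₁ where
    field
      D     : Set
      point : D
      ⟦_⟧   : (f : Fun) → Vec D (arity f) → D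

  module _ (I : Interp) where
    open Interp I

    mutual
      eval : (ℕ → D) → Term → D
      eval α (var x) = α x
      eval α (fun f ts) = ⟦ f ⟧ (eval* α ts)

      eval* : ∀ {n} → (ℕ → D) → Vec Term n → Vec D n
      eval* α [] = []
      eval* α (t ∷ ts) = eval α t ∷ eval* α ts

    TrueLit : (ℕ → D) → Lit → Set
    TrueLit α (lit ≈ s t) = eval α s ≡ eval α t
    TrueLit α (lit ≉ s t) = ¬ (eval α s ≡ eval α t)

    ModelsClause : Clause → Set
    ModelsClause C = ∀ (α : ℕ → D) → Any (TrueLit α) C

  _⊨_ : (Clause → Set) → Clause → Set₁
  N ⊨ C = ∀ (I : Interp) → (∀ D → N D → ModelsClause I D) → ModelsClause I C

module Submission where

-- The conclusion of the inference is (L[r₁]_p ∨ C₁ ∨ C)μ, where L ∨ C is the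
-- second premise (instantiated by δ in case (b)). Its closure substitution θ
-- unifies L|_p with l₁, so it absorbs the idempotent mgu μ; θ agrees with σ₁ on
-- the first premise (which σ₁ grounds) and sends L ∨ C to (l₂ # r₂ ∨ C₂)σ₂
-- (by variable disjointness, and in case (b) by the defining equation of δ and
-- ρ). Hence the conclusion closure is the ground rewrite of the second premise
-- at p, which gives (1); (2) holds because ≺ is compatible with contexts, and
-- (3) is soundness of paramodulation for the μ-instances of the premises.

open import Defs
open import Data.Nat using (ℕ; zero; suc)
open import Data.Nat.Properties using (_≟_)
open import Data.List using ([]; _∷_; _++_)
open import Data.List.Properties using (∷-injective; ++-conicalˡ; ++-conicalʳ)
open import Data.List.Membership.Propositional using (_∈_)
open import Data.List.Membership.Propositional.Properties using (∈-++⁺ˡ; ∈-++⁺ʳ; ∈-++⁻)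
open import Data.List.Relation.Unary.Any using (Any; here; there)
open import Data.List.Relation.Unary.Any.Properties using (++⁺ˡ; ++⁺ʳ)
open import Data.List.Relation.Unary.All using ([]; _∷_)
open import Data.List.Relation.Binary.Permutation.Propositional using (↭-refl; swap)
open import Data.List.Relation.Binary.Permutation.Propositional.Properties using (++-comm)
open import Data.Vec using (Vec; []; _∷_)
import Data.Vec.Properties as Vec
open import Data.Maybe using (just)
open import Data.Maybe.Properties using (just-injective)
open import Data.Product using (_×_; _,_; proj₁; proj₂)
open import Data.Sum using (inj₁; inj₂)
open import Function using (_∘_)
open import Relation.Nullary using (¬_; Dec; yes; no)
open import Relation.Nullary.Decidable using (decidable-stable)
import Relation.Nullary.Decidable as Dec
open import Relation.Binary.PropositionalEquality
  using (_≡_; refl; sym; trans; cong; cong₂; subst; module ≡-Reasoning)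

module Rewriting (Fun : Set) (arity : Fun → ℕ) where
  open FOL Fun arity
  open ≡-Reasoning

  mutual
    ⟨⟩-local : ∀ t {σ τ} → (∀ x → x ∈ varsT t → σ x ≡ τ x) → t ⟨ σ ⟩ ≡ t ⟨ τ ⟩
    ⟨⟩-local (var x) σ≗τ = σ≗τ x (here refl)
    ⟨⟩-local (fun f ts) σ≗τ = cong (fun f) (⟨⟩*-local ts σ≗τ)

    ⟨⟩*-local : ∀ {n} (ts : Vec Term n) {σ τ} →
                (∀ x → x ∈ varsT* ts → σ x ≡ τ x) → ts ⟨ σ ⟩* ≡ ts ⟨ τ ⟩*
    ⟨⟩*-local [] σ≗τ = refl
    ⟨⟩*-local (t ∷ ts) σ≗τ =
      cong₂ _∷_ (⟨⟩-local t (λ x m → σ≗τ x (∈-++⁺ˡ m)))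
                (⟨⟩*-local ts (λ x m → σ≗τ x (∈-++⁺ʳ (varsT t) m)))

  ⟪⟫-local : ∀ L {σ τ} → (∀ x → x ∈ varsL L → σ x ≡ τ x) → L ⟪ σ ⟫ ≡ L ⟪ τ ⟫
  ⟪⟫-local (lit b s t) σ≗τ =
    cong₂ (lit b) (⟨⟩-local s (λ x m → σ≗τ x (∈-++⁺ˡ m)))
                  (⟨⟩-local t (λ x m → σ≗τ x (∈-++⁺ʳ (varsT s) m)))

  ⟪⟫c-local : ∀ C {σ τ} → (∀ x → x ∈ varsC C → σ x ≡ τ x) → C ⟪ σ ⟫c ≡ C ⟪ τ ⟫c
  ⟪⟫c-local [] σ≗τ = refl
  ⟪⟫c-local (L ∷ C) σ≗τ =
    cong₂ _∷_ (⟪⟫-local L (λ x m → σ≗τ x (∈-++⁺ˡ m)))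
              (⟪⟫c-local C (λ x m → σ≗τ x (∈-++⁺ʳ (varsL L) m)))

  fun-injective : ∀ {f} {ts us : Vec Term (arity f)} → fun f ts ≡ fun f us → ts ≡ us
  fun-injective refl = refl

  mutual
    ⟨⟩-local⁻¹ : ∀ t {σ τ} → t ⟨ σ ⟩ ≡ t ⟨ τ ⟩ → ∀ x → x ∈ varsT t → σ x ≡ τ x
    ⟨⟩-local⁻¹ (var y) eq x (here refl) = eq
    ⟨⟩-local⁻¹ (fun f ts) eq = ⟨⟩*-local⁻¹ ts (fun-injective eq)

    ⟨⟩*-local⁻¹ : ∀ {n} (ts : Vec Term n) {σ τ} →
                  ts ⟨ σ ⟩* ≡ ts ⟨ τ ⟩* → ∀ x → x ∈ varsT* ts → σ x ≡ τ x
    ⟨⟩*-local⁻¹ (t ∷ ts) eq x m with Vec.∷-injective eq | ∈-++⁻ (varsT t) m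
    ... | eqₜ , _   | inj₁ m′ = ⟨⟩-local⁻¹ t eqₜ x m′
    ... | _   , eqₛ | inj₂ m′ = ⟨⟩*-local⁻¹ ts eqₛ x m′

  lit-injective : ∀ {b s t s′ t′} → lit b s t ≡ lit b s′ t′ → s ≡ s′ × t ≡ t′
  lit-injective refl = refl , refl

  ⟪⟫-local⁻¹ : ∀ L {σ τ} → L ⟪ σ ⟫ ≡ L ⟪ τ ⟫ → ∀ x → x ∈ varsL L → σ x ≡ τ x
  ⟪⟫-local⁻¹ (lit b s t) eq x m with lit-injective eq | ∈-++⁻ (varsT s) m
  ... | eqₛ , _   | inj₁ m′ = ⟨⟩-local⁻¹ s eqₛ x m′
  ... | _   , eqₜ | inj₂ m′ = ⟨⟩-local⁻¹ t eqₜ x m′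

  mutual
    ⟨⟩-⊙ : ∀ t σ τ → (t ⟨ σ ⟩) ⟨ τ ⟩ ≡ t ⟨ σ ⊙ τ ⟩
    ⟨⟩-⊙ (var x) σ τ = refl
    ⟨⟩-⊙ (fun f ts) σ τ = cong (fun f) (⟨⟩*-⊙ ts σ τ)

    ⟨⟩*-⊙ : ∀ {n} (ts : Vec Term n) σ τ → (ts ⟨ σ ⟩*) ⟨ τ ⟩* ≡ ts ⟨ σ ⊙ τ ⟩*
    ⟨⟩*-⊙ [] σ τ = refl
    ⟨⟩*-⊙ (t ∷ ts) σ τ = cong₂ _∷_ (⟨⟩-⊙ t σ τ) (⟨⟩*-⊙ ts σ τ)

  ⟪⟫-⊙ : ∀ L σ τ → (L ⟪ σ ⟫) ⟪ τ ⟫ ≡ L ⟪ σ ⊙ τ ⟫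
  ⟪⟫-⊙ (lit b s t) σ τ = cong₂ (lit b) (⟨⟩-⊙ s σ τ) (⟨⟩-⊙ t σ τ)

  ⟪⟫c-⊙ : ∀ C σ τ → (C ⟪ σ ⟫c) ⟪ τ ⟫c ≡ C ⟪ σ ⊙ τ ⟫c
  ⟪⟫c-⊙ [] σ τ = refl
  ⟪⟫c-⊙ (L ∷ C) σ τ = cong₂ _∷_ (⟪⟫-⊙ L σ τ) (⟪⟫c-⊙ C σ τ)

  ⊙-assoc : ∀ σ τ υ x → ((σ ⊙ τ) ⊙ υ) x ≡ (σ ⊙ (τ ⊙ υ)) x
  ⊙-assoc σ τ υ x = ⟨⟩-⊙ (σ x) τ υ

  ⟪⟫c-++ : ∀ A B σ → (A ++ B) ⟪ σ ⟫c ≡ A ⟪ σ ⟫c ++ B ⟪ σ ⟫c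
  ⟪⟫c-++ [] B σ = refl
  ⟪⟫c-++ (L ∷ A) B σ = cong (L ⟪ σ ⟫ ∷_) (⟪⟫c-++ A B σ)

  ground-⟨⟩ : ∀ t σ → Ground t → t ⟨ σ ⟩ ≡ t
  ground-⟨⟩ (var x) σ ()
  ground-⟨⟩ (fun f ts) σ g = cong (fun f) (ground-⟨⟩* ts g)
    where
      ground-⟨⟩* : ∀ {n} (ts : Vec Term n) → varsT* ts ≡ [] → ts ⟨ σ ⟩* ≡ ts
      ground-⟨⟩* [] _ = refl
      ground-⟨⟩* (t ∷ ts) g =
        cong₂ _∷_ (ground-⟨⟩ t σ (++-conicalˡ (varsT t) _ g)) (ground-⟨⟩* ts (++-conicalʳ (varsT t) _ g))

  grounding-⊙ : ∀ C {σ} τ → Grounds σ C → C ⟪ σ ⊙ τ ⟫c ≡ C ⟪ σ ⟫c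
  grounding-⊙ C {σ} τ g = ⟪⟫c-local C (λ x m → ground-⟨⟩ (σ x) τ (g x m))

  grounding-⊙-⊙ : ∀ C {σ} τ υ → Grounds σ C → C ⟪ (σ ⊙ τ) ⊙ υ ⟫c ≡ C ⟪ σ ⟫c
  grounding-⊙-⊙ C {σ} τ υ g =
    ⟪⟫c-local C (λ x m → trans (cong (_⟨ υ ⟩) (ground-⟨⟩ (σ x) τ (g x m))) (ground-⟨⟩ (σ x) υ (g x m)))

  identity-⊙ : ∀ C {σ} τ → (∀ x → x ∈ varsC C → σ x ≡ var x) → C ⟪ σ ⊙ τ ⟫c ≡ C ⟪ τ ⟫c
  identity-⊙ C τ id = ⟪⟫c-local C (λ x m → cong (_⟨ τ ⟩) (id x m))

  var-injective : ∀ {x y} → var x ≡ var y → x ≡ y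
  var-injective refl = refl

  _≟var_ : ∀ t x → Dec (t ≡ var x)
  var y ≟var x = Dec.map′ (cong var) var-injective (y ≟ x)
  fun f ts ≟var x = no (λ ())

  ∉dom⇒var : ∀ {σ x} → ¬ dom σ x → σ x ≡ var x
  ∉dom⇒var {σ} {x} = decidable-stable (σ x ≟var x)

  mutual
    subterm-⟨⟩ : ∀ t q {u} σ → subterm t q ≡ just u → subterm (t ⟨ σ ⟩) q ≡ just (u ⟨ σ ⟩)
    subterm-⟨⟩ t [] σ refl = refl
    subterm-⟨⟩ (fun f ts) (i ∷ q) σ at = subterm*-⟨⟩ ts i q σ at

    subterm*-⟨⟩ : ∀ {n} (ts : Vec Term n) i q {u} σ →
                  subterm* ts i q ≡ just u → subterm* (ts ⟨ σ ⟩*) i q ≡ just (u ⟨ σ ⟩)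
    subterm*-⟨⟩ (t ∷ ts) zero q σ at = subterm-⟨⟩ t q σ at
    subterm*-⟨⟩ (t ∷ ts) (suc i) q σ at = subterm*-⟨⟩ ts i q σ at

  mutual
    replace-⟨⟩ : ∀ t q {u} s σ → subterm t q ≡ just u →
                 (replace t q s) ⟨ σ ⟩ ≡ replace (t ⟨ σ ⟩) q (s ⟨ σ ⟩)
    replace-⟨⟩ t [] s σ refl = refl
    replace-⟨⟩ (fun f ts) (i ∷ q) s σ at = cong (fun f) (replace*-⟨⟩ ts i q s σ at)

    replace*-⟨⟩ : ∀ {n} (ts : Vec Term n) i q {u} s σ → subterm* ts i q ≡ just u →
                  (replace* ts i q s) ⟨ σ ⟩* ≡ replace* (ts ⟨ σ ⟩*) i q (s ⟨ σ ⟩)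
    replace*-⟨⟩ (t ∷ ts) zero q s σ at = cong (_∷ ts ⟨ σ ⟩*) (replace-⟨⟩ t q s σ at)
    replace*-⟨⟩ (t ∷ ts) (suc i) q s σ at = cong (t ⟨ σ ⟩ ∷_) (replace*-⟨⟩ ts i q s σ at)

  mutual
    replace-subterm : ∀ t q {u} → subterm t q ≡ just u → replace t q u ≡ t
    replace-subterm t [] refl = refl
    replace-subterm (fun f ts) (i ∷ q) at = cong (fun f) (replace*-subterm* ts i q at)

    replace*-subterm* : ∀ {n} (ts : Vec Term n) i q {u} → subterm* ts i q ≡ just u →
                        replace* ts i q u ≡ ts
    replace*-subterm* (t ∷ ts) zero q at = cong (_∷ ts) (replace-subterm t q at)
    replace*-subterm* (t ∷ ts) (suc i) q at = cong (t ∷_) (replace*-subterm* ts i q at)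

  litAt-⟪⟫ : ∀ L p {u} σ → litAt L p ≡ just u → litAt (L ⟪ σ ⟫) p ≡ just (u ⟨ σ ⟩)
  litAt-⟪⟫ (lit b s t) (0 ∷ q) σ at = subterm-⟨⟩ s q σ at
  litAt-⟪⟫ (lit b s t) (1 ∷ q) σ at = subterm-⟨⟩ t q σ at

  litReplace-⟪⟫ : ∀ L p {u} r σ → litAt L p ≡ just u →
                  (litReplace L p r) ⟪ σ ⟫ ≡ litReplace (L ⟪ σ ⟫) p (r ⟨ σ ⟩)
  litReplace-⟪⟫ (lit b s t) (0 ∷ q) r σ at = cong (λ s′ → lit b s′ (t ⟨ σ ⟩)) (replace-⟨⟩ s q r σ at)
  litReplace-⟪⟫ (lit b s t) (1 ∷ q) r σ at = cong (lit b (s ⟨ σ ⟩)) (replace-⟨⟩ t q r σ at)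

  -- θ = μ ⊙ η for some η by generality, and μ ⊙ μ = μ.
  mgu-⊙-unifier : ∀ {μ s t} → IsMGU μ s t → ∀ θ → s ⟨ θ ⟩ ≡ t ⟨ θ ⟩ → ∀ x → (μ x) ⟨ θ ⟩ ≡ θ x
  mgu-⊙-unifier {μ} mgu θ unifies x with IsMGU.general mgu θ unifies
  ... | η , θ≗μ⊙η = begin
    μ x ⟨ θ ⟩          ≡⟨ ⟨⟩-local (μ x) (λ y _ → θ≗μ⊙η y) ⟩
    μ x ⟨ μ ⊙ η ⟩      ≡⟨ ⟨⟩-⊙ (μ x) μ η ⟨
    (μ x ⟨ μ ⟩) ⟨ η ⟩  ≡⟨ cong (_⟨ η ⟩) (IsMGU.idempotent mgu x) ⟩
    μ x ⟨ η ⟩          ≡⟨ θ≗μ⊙η x ⟨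
    θ x                ∎

  module _ (O : DesiredOrdering) where
    open DesiredOrdering O using (_≺_; _≺L_; ctx)

    replace-≺ : ∀ t q {u} s → subterm t q ≡ just u → s ≺ u → replace t q s ≺ t
    replace-≺ t q {u} s at s≺u =
      subst (replace t q s ≺_) (replace-subterm t q at) (ctx t q (u , at) s≺u)

    litReplace-≺L : ∀ L p {u} r → litAt L p ≡ just u → r ≺ u → litReplace L p r ≺L L
    litReplace-≺L (lit ≈ s t) (0 ∷ q) r at r≺u =
      t ∷ [] , s ∷ [] , replace s q r ∷ [] , (λ ()) , swap s t ↭-refl , swap _ t ↭-refl ,
      here (replace-≺ s q r at r≺u) ∷ []
    litReplace-≺L (lit ≉ s t) (0 ∷ q) r at r≺u =
      t ∷ t ∷ [] , s ∷ s ∷ [] , s′ ∷ s′ ∷ [] , (λ ()) ,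
      ++-comm (s ∷ s ∷ []) (t ∷ t ∷ []) , ++-comm (s′ ∷ s′ ∷ []) (t ∷ t ∷ []) ,
      here s′≺s ∷ here s′≺s ∷ []
      where
        s′ = replace s q r
        s′≺s = replace-≺ s q r at r≺u
    litReplace-≺L (lit ≈ s t) (1 ∷ q) r at r≺u =
      s ∷ [] , t ∷ [] , replace t q r ∷ [] , (λ ()) , ↭-refl , ↭-refl ,
      here (replace-≺ t q r at r≺u) ∷ []
    litReplace-≺L (lit ≉ s t) (1 ∷ q) r at r≺u =
      s ∷ s ∷ [] , t ∷ t ∷ [] , t′ ∷ t′ ∷ [] , (λ ()) , ↭-refl , ↭-refl ,
      here t′≺t ∷ here t′≺t ∷ []
      where
        t′ = replace t q r
        t′≺t = replace-≺ t q r at r≺u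

  module _ (I : Interp) where
    open Interp I

    mutual
      eval-⟨⟩ : ∀ α t σ → eval I α (t ⟨ σ ⟩) ≡ eval I (eval I α ∘ σ) t
      eval-⟨⟩ α (var x) σ = refl
      eval-⟨⟩ α (fun f ts) σ = cong ⟦ f ⟧ (eval*-⟨⟩ α ts σ)

      eval*-⟨⟩ : ∀ {n} α (ts : Vec Term n) σ → eval* I α (ts ⟨ σ ⟩*) ≡ eval* I (eval I α ∘ σ) ts
      eval*-⟨⟩ α [] σ = refl
      eval*-⟨⟩ α (t ∷ ts) σ = cong₂ _∷_ (eval-⟨⟩ α t σ) (eval*-⟨⟩ α ts σ)

    mutual
      eval-replace : ∀ α t q {u} s → subterm t q ≡ just u → eval I α u ≡ eval I α s →
                     eval I α (replace t q s) ≡ eval I α t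
      eval-replace α t [] s refl u≈s = sym u≈s
      eval-replace α (fun f ts) (i ∷ q) s at u≈s = cong ⟦ f ⟧ (eval*-replace α ts i q s at u≈s)

      eval*-replace : ∀ {n} α (ts : Vec Term n) i q {u} s → subterm* ts i q ≡ just u →
                      eval I α u ≡ eval I α s → eval* I α (replace* ts i q s) ≡ eval* I α ts
      eval*-replace α (t ∷ ts) zero q s at u≈s =
        cong (_∷ eval* I α ts) (eval-replace α t q s at u≈s)
      eval*-replace α (t ∷ ts) (suc i) q s at u≈s =
        cong (eval I α t ∷_) (eval*-replace α ts i q s at u≈s)

    TrueLit-⟪⟫ : ∀ α L σ → TrueLit I (eval I α ∘ σ) L → TrueLit I α (L ⟪ σ ⟫)
    TrueLit-⟪⟫ α (lit ≈ s t) σ s≈t = trans (eval-⟨⟩ α s σ) (trans s≈t (sym (eval-⟨⟩ α t σ)))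
    TrueLit-⟪⟫ α (lit ≉ s t) σ s≉t s≈t = s≉t (trans (sym (eval-⟨⟩ α s σ)) (trans s≈t (eval-⟨⟩ α t σ)))

    models-⟪⟫c : ∀ {C} σ → ModelsClause I C → ModelsClause I (C ⟪ σ ⟫c)
    models-⟪⟫c {C} σ ⊨C α = true-⟪⟫c C (⊨C (eval I α ∘ σ))
      where
        true-⟪⟫c : ∀ C → Any (TrueLit I (eval I α ∘ σ)) C → Any (TrueLit I α) (C ⟪ σ ⟫c)
        true-⟪⟫c (L ∷ C) (here L-true) = here (TrueLit-⟪⟫ α L σ L-true)
        true-⟪⟫c (L ∷ C) (there C-true) = there (true-⟪⟫c C C-true)

    TrueLit-litReplace : ∀ α L p {u} r → litAt L p ≡ just u → eval I α u ≡ eval I α r →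
                         TrueLit I α L → TrueLit I α (litReplace L p r)
    TrueLit-litReplace α (lit ≈ s t) (0 ∷ q) r at u≈r s≈t = trans (eval-replace α s q r at u≈r) s≈t
    TrueLit-litReplace α (lit ≉ s t) (0 ∷ q) r at u≈r s≉t =
      λ s′≈t → s≉t (trans (sym (eval-replace α s q r at u≈r)) s′≈t)
    TrueLit-litReplace α (lit ≈ s t) (1 ∷ q) r at u≈r s≈t = trans s≈t (sym (eval-replace α t q r at u≈r))
    TrueLit-litReplace α (lit ≉ s t) (1 ∷ q) r at u≈r s≉t =
      λ s≈t′ → s≉t (trans s≈t′ (eval-replace α t q r at u≈r))

    paramodulation-sound : ∀ {l r C₁ L C p} → litAt L p ≡ just l →
      ModelsClause I (lit ≈ l r ∷ C₁) → ModelsClause I (L ∷ C) →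
      ModelsClause I (litReplace L p r ∷ C₁ ++ C)
    paramodulation-sound {r = r} {C₁} {L} {C} {p} at ⊨₁ ⊨₂ α with ⊨₁ α | ⊨₂ α
    ... | there C₁-true | _            = there (++⁺ˡ C₁-true)
    ... | here _        | there C-true = there (++⁺ʳ C₁ C-true)
    ... | here l≈r      | here L-true  = here (TrueLit-litReplace α L p r at l≈r L-true)

    inference-sound : ∀ {l₁ r₁ C₁ L C p u μ} → litAt L p ≡ just u → u ⟨ μ ⟩ ≡ l₁ ⟨ μ ⟩ →
      ModelsClause I (lit ≈ l₁ r₁ ∷ C₁) → ModelsClause I (L ∷ C) →
      ModelsClause I ((litReplace L p r₁) ⟪ μ ⟫ ∷ C₁ ⟪ μ ⟫c ++ C ⟪ μ ⟫c)
    inference-sound {r₁ = r₁} {C₁} {L} {C} {p} {μ = μ} at unifies ⊨₁ ⊨₂ =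
      subst (λ K → ModelsClause I (K ∷ C₁ ⟪ μ ⟫c ++ C ⟪ μ ⟫c))
            (sym (litReplace-⟪⟫ L p r₁ μ at))
            (paramodulation-sound (subst (λ v → litAt (L ⟪ μ ⟫) p ≡ just v) unifies (litAt-⟪⟫ L p μ at))
                                  (models-⟪⟫c μ ⊨₁) (models-⟪⟫c μ ⊨₂))

  module DisjointPremises (K₁ : Lit) (C₁ : Clause) (σ₁ : Subst) (t₁ : Sub)
                          (L₂ : Lit) (C₂ : Clause) (σ₂ : Subst) (t₂ : Sub)
                          (disjoint : VarDisjoint (mk K₁ C₁ σ₁ t₁) (mk L₂ C₂ σ₂ t₂)) where

    σ₁-fixes-premise₂ : ∀ x → x ∈ varsC (L₂ ∷ C₂) → σ₁ x ≡ var x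
    σ₁-fixes-premise₂ x m = ∉dom⇒var {σ₁} (λ x∈dom → disjoint x (inj₂ x∈dom) (inj₁ m))

    premises-⊙ : Grounds σ₁ (K₁ ∷ C₁) → (C₁ ++ C₂) ⟪ σ₁ ⊙ σ₂ ⟫c ≡ C₁ ⟪ σ₁ ⟫c ++ C₂ ⟪ σ₂ ⟫c
    premises-⊙ ground₁ = begin
      (C₁ ++ C₂) ⟪ σ₁ ⊙ σ₂ ⟫c                 ≡⟨ ⟪⟫c-++ C₁ C₂ (σ₁ ⊙ σ₂) ⟩
      C₁ ⟪ σ₁ ⊙ σ₂ ⟫c ++ C₂ ⟪ σ₁ ⊙ σ₂ ⟫c      ≡⟨ cong₂ _++_ C₁-ground C₂-untouched ⟩
      C₁ ⟪ σ₁ ⟫c ++ C₂ ⟪ σ₂ ⟫c                ∎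
      where
        C₁-ground = proj₂ (∷-injective (grounding-⊙ (K₁ ∷ C₁) σ₂ ground₁))
        C₂-untouched = proj₂ (∷-injective (identity-⊙ (L₂ ∷ C₂) σ₂ σ₁-fixes-premise₂))

    -- Outside dom δ this is groundness of σ₂, inside it (dom δ ⊆ vars L₂) the
    -- equation L₂δσ₂ρ = L₂σ₂; σ₁ drops out because δ only introduces variables
    -- fresh for the first premise.
    mgInst-⊙ : ∀ {p δ ρ} → Grounds σ₂ (L₂ ∷ C₂) →
      MGInst (FreshFor (mk K₁ C₁ σ₁ t₁) (mk L₂ C₂ σ₂ t₂)) L₂ p σ₂ δ ρ →
      ((L₂ ∷ C₂) ⟪ δ ⟫c) ⟪ (σ₁ ⊙ σ₂) ⊙ ρ ⟫c ≡ (L₂ ∷ C₂) ⟪ σ₂ ⟫c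
    mgInst-⊙ {δ = δ} {ρ} ground₂ mgInst = begin
      ((L₂ ∷ C₂) ⟪ δ ⟫c) ⟪ θ ⟫c  ≡⟨ ⟪⟫c-⊙ (L₂ ∷ C₂) δ θ ⟩
      (L₂ ∷ C₂) ⟪ δ ⊙ θ ⟫c       ≡⟨ ⟪⟫c-local (L₂ ∷ C₂) δ⊙θ≗σ₂ ⟩
      (L₂ ∷ C₂) ⟪ σ₂ ⟫c          ∎
      where
        θ = (σ₁ ⊙ σ₂) ⊙ ρ
        open MGInst mgInst

        L₂-instance : L₂ ⟪ δ ⊙ (σ₂ ⊙ ρ) ⟫ ≡ L₂ ⟪ σ₂ ⟫
        L₂-instance = begin
          L₂ ⟪ δ ⊙ (σ₂ ⊙ ρ) ⟫         ≡⟨ ⟪⟫-⊙ L₂ δ (σ₂ ⊙ ρ) ⟨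
          (L₂ ⟪ δ ⟫) ⟪ σ₂ ⊙ ρ ⟫       ≡⟨ ⟪⟫-⊙ (L₂ ⟪ δ ⟫) σ₂ ρ ⟨
          ((L₂ ⟪ δ ⟫) ⟪ σ₂ ⟫) ⟪ ρ ⟫   ≡⟨ inst ⟩
          L₂ ⟪ σ₂ ⟫                   ∎

        δ-instance : ∀ x → x ∈ varsC (L₂ ∷ C₂) → (δ x) ⟨ σ₂ ⊙ ρ ⟩ ≡ σ₂ x
        δ-instance x m with δ x ≟var x
        ... | yes δx≡x = trans (cong (_⟨ σ₂ ⊙ ρ ⟩) δx≡x) (ground-⟨⟩ (σ₂ x) ρ (ground₂ x m))
        ... | no x∈dom = ⟪⟫-local⁻¹ L₂ L₂-instance x (domδ x x∈dom)

        σ₁-fixes-δ : ∀ x → x ∈ varsC (L₂ ∷ C₂) → ∀ y → y ∈ varsT (δ x) → σ₁ y ≡ var y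
        σ₁-fixes-δ x m y y∈δx with δ x ≟var x
        ... | no x∈dom = ∉dom⇒var {σ₁} (λ y∈dom → proj₁ (freshδ x y x∈dom y∈δx) (inj₂ y∈dom))
        ... | yes δx≡x with subst (λ t → y ∈ varsT t) δx≡x y∈δx
        ...   | here refl = σ₁-fixes-premise₂ y m

        δ⊙θ≗σ₂ : ∀ x → x ∈ varsC (L₂ ∷ C₂) → (δ x) ⟨ θ ⟩ ≡ σ₂ x
        δ⊙θ≗σ₂ x m = begin
          (δ x) ⟨ θ ⟩              ≡⟨ ⟨⟩-local (δ x) (λ y _ → ⊙-assoc σ₁ σ₂ ρ y) ⟩
          (δ x) ⟨ σ₁ ⊙ (σ₂ ⊙ ρ) ⟩  ≡⟨ ⟨⟩-local (δ x) (λ y y∈δx → cong (_⟨ σ₂ ⊙ ρ ⟩) (σ₁-fixes-δ x m y y∈δx)) ⟩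
          (δ x) ⟨ σ₂ ⊙ ρ ⟩         ≡⟨ δ-instance x m ⟩
          σ₂ x                     ∎

  conclusion-closure : ∀ {l₁ r₁ C₁ σ₁ L₂ C₂ σ₂ p L C u μ θ} →
    litAt L p ≡ just u → IsMGU μ u l₁ → litAt (L₂ ⟪ σ₂ ⟫) p ≡ just (l₁ ⟨ σ₁ ⟩) →
    (lit ≈ l₁ r₁ ∷ C₁) ⟪ θ ⟫c ≡ (lit ≈ l₁ r₁ ∷ C₁) ⟪ σ₁ ⟫c →
    (L ∷ C) ⟪ θ ⟫c ≡ (L₂ ∷ C₂) ⟪ σ₂ ⟫c →
    ((C₁ ⟪ μ ⟫c ++ C ⟪ μ ⟫c) ⟪ θ ⟫c ≡ C₁ ⟪ σ₁ ⟫c ++ C₂ ⟪ σ₂ ⟫c)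
    × ((litReplace L p r₁ ⟪ μ ⟫) ⟪ θ ⟫ ≡ litReplace (L₂ ⟪ σ₂ ⟫) p (r₁ ⟨ σ₁ ⟩))
  conclusion-closure {l₁} {r₁} {C₁} {σ₁} {L₂} {C₂} {σ₂} {p} {L} {C} {u} {μ} {θ}
                     at mgu at₂ premise₁ premise₂ = side , rewritten
    where
      l₁θ = proj₁ (lit-injective (proj₁ (∷-injective premise₁)))
      r₁θ = proj₂ (lit-injective (proj₁ (∷-injective premise₁)))
      C₁θ = proj₂ (∷-injective premise₁)
      Lθ = proj₁ (∷-injective premise₂)
      Cθ = proj₂ (∷-injective premise₂)

      θ-unifies : u ⟨ θ ⟩ ≡ l₁ ⟨ θ ⟩
      θ-unifies = just-injective (begin
        just (u ⟨ θ ⟩)        ≡⟨ litAt-⟪⟫ L p θ at ⟨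
        litAt (L ⟪ θ ⟫) p     ≡⟨ cong (λ K → litAt K p) Lθ ⟩
        litAt (L₂ ⟪ σ₂ ⟫) p   ≡⟨ at₂ ⟩
        just (l₁ ⟨ σ₁ ⟩)      ≡⟨ cong just l₁θ ⟨
        just (l₁ ⟨ θ ⟩)       ∎)

      μ⊙θ≗θ : ∀ x → (μ x) ⟨ θ ⟩ ≡ θ x
      μ⊙θ≗θ = mgu-⊙-unifier mgu θ θ-unifies

      side = begin
        (C₁ ⟪ μ ⟫c ++ C ⟪ μ ⟫c) ⟪ θ ⟫c                ≡⟨ ⟪⟫c-++ (C₁ ⟪ μ ⟫c) (C ⟪ μ ⟫c) θ ⟩
        (C₁ ⟪ μ ⟫c) ⟪ θ ⟫c ++ (C ⟪ μ ⟫c) ⟪ θ ⟫c       ≡⟨ cong₂ _++_ (⟪⟫c-⊙ C₁ μ θ) (⟪⟫c-⊙ C μ θ) ⟩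
        C₁ ⟪ μ ⊙ θ ⟫c ++ C ⟪ μ ⊙ θ ⟫c                 ≡⟨ cong₂ _++_ (⟪⟫c-local C₁ (λ x _ → μ⊙θ≗θ x))
                                                                     (⟪⟫c-local C (λ x _ → μ⊙θ≗θ x)) ⟩
        C₁ ⟪ θ ⟫c ++ C ⟪ θ ⟫c                         ≡⟨ cong₂ _++_ C₁θ Cθ ⟩
        C₁ ⟪ σ₁ ⟫c ++ C₂ ⟪ σ₂ ⟫c                      ∎

      rewritten = begin
        (litReplace L p r₁ ⟪ μ ⟫) ⟪ θ ⟫        ≡⟨ ⟪⟫-⊙ (litReplace L p r₁) μ θ ⟩
        litReplace L p r₁ ⟪ μ ⊙ θ ⟫            ≡⟨ ⟪⟫-local (litReplace L p r₁) (λ x _ → μ⊙θ≗θ x) ⟩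
        litReplace L p r₁ ⟪ θ ⟫                ≡⟨ litReplace-⟪⟫ L p r₁ θ at ⟩
        litReplace (L ⟪ θ ⟫) p (r₁ ⟨ θ ⟩)      ≡⟨ cong₂ (λ K r → litReplace K p r) Lθ r₁θ ⟩
        litReplace (L₂ ⟪ σ₂ ⟫) p (r₁ ⟨ σ₁ ⟩)   ∎

  module _ (O : DesiredOrdering) where
    open DesiredOrdering O using (_≺_; _≺L_)

    inference-properties : ∀ {l₁ r₁ C₁ σ₁ L₂ C₂ σ₂ p L C u μ θ} →
      (r₁ ⟨ σ₁ ⟩) ≺ (l₁ ⟨ σ₁ ⟩) → litAt (L₂ ⟪ σ₂ ⟫) p ≡ just (l₁ ⟨ σ₁ ⟩) →
      litAt L p ≡ just u → IsMGU μ u l₁ →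
      (C₁ ++ C₂) ⟪ σ₁ ⊙ σ₂ ⟫c ≡ C₁ ⟪ σ₁ ⟫c ++ C₂ ⟪ σ₂ ⟫c →
      (lit ≈ l₁ r₁ ∷ C₁) ⟪ θ ⟫c ≡ (lit ≈ l₁ r₁ ∷ C₁) ⟪ σ₁ ⟫c →
      (L ∷ C) ⟪ θ ⟫c ≡ (L₂ ∷ C₂) ⟪ σ₂ ⟫c →
      (∀ I → ModelsClause I (L₂ ∷ C₂) → ModelsClause I (L ∷ C)) →
      let L₃ = litReplace L p r₁ ⟪ μ ⟫
          C₃ = C₁ ⟪ μ ⟫c ++ C ⟪ μ ⟫c in
      ((C₃ ⟪ θ ⟫c ≡ (C₁ ++ C₂) ⟪ σ₁ ⊙ σ₂ ⟫c)
        × (L₃ ⟪ θ ⟫ ≡ litReplace (L₂ ⟪ σ₂ ⟫) p (r₁ ⟨ σ₁ ⟩)))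
      × ((L₃ ⟪ θ ⟫) ≺L (L₂ ⟪ σ₂ ⟫))
      × (∀ (N : Clause → Set) → N ⊨ (lit ≈ l₁ r₁ ∷ C₁) → N ⊨ (L₂ ∷ C₂) → N ⊨ (L₃ ∷ C₃))
    inference-properties {r₁ = r₁} {σ₁ = σ₁} {L₂ = L₂} {σ₂ = σ₂} {p}
                         r₁≺l₁ at₂ at mgu split premise₁ premise₂ instance₂
      with conclusion-closure at mgu at₂ premise₁ premise₂
    ... | side , rewritten =
      (trans side (sym split) , rewritten) ,
      subst (_≺L (L₂ ⟪ σ₂ ⟫)) (sym rewritten) (litReplace-≺L O (L₂ ⟪ σ₂ ⟫) p (r₁ ⟨ σ₁ ⟩) at₂ r₁≺l₁) ,
      λ N ⊨₁ ⊨₂ I ⊨N → inference-sound I at (IsMGU.unifies mgu) (⊨₁ I ⊨N) (instance₂ I (⊨₂ I ⊨N))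

lemma3 : (Fun : Set) (arity : Fun → ℕ) →
  let open FOL Fun arity in
  (O : DesiredOrdering) →
  let open DesiredOrdering O in
  ∀ (l₁ r₁ : Term) (C₁ : Clause) (σ₁ : Subst) (t₁ : Sub)
    (L₂ : Lit) (C₂ : Clause) (σ₂ : Subst) (t₂ : Sub)
    (p : Pos) (L₃ : Lit) (C₃ : Clause) (σ₃ : Subst) (t₃ : Sub) →
  let I₁ = mk (lit ≈ l₁ r₁) C₁ σ₁ t₁
      I₂ = mk L₂ C₂ σ₂ t₂
      I₃ = mk L₃ C₃ σ₃ t₃ in
  WF I₁ → WF I₂ → VarDisjoint I₁ I₂ →
  (r₁ ⟨ σ₁ ⟩) ≺ (l₁ ⟨ σ₁ ⟩) →
  litAt (L₂ ⟪ σ₂ ⟫) p ≡ just (l₁ ⟨ σ₁ ⟩) →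
  RewriteInference I₁ I₂ p I₃ →
  ((C₃ ⟪ σ₃ ⟫c ≡ (C₁ ++ C₂) ⟪ σ₁ ⊙ σ₂ ⟫c)
    × (L₃ ⟪ σ₃ ⟫ ≡ litReplace (L₂ ⟪ σ₂ ⟫) p (r₁ ⟨ σ₁ ⟩)))
  × ((L₃ ⟪ σ₃ ⟫) ≺L (L₂ ⟪ σ₂ ⟫))
  × (∀ (N : Clause → Set) →
       N ⊨ (lit ≈ l₁ r₁ ∷ C₁) → N ⊨ (L₂ ∷ C₂) → N ⊨ (L₃ ∷ C₃))
lemma3 Fun arity O l₁ r₁ C₁ σ₁ t₁ L₂ C₂ σ₂ t₂ p _ _ _ _ (ground₁ , _) _ disjoint r₁≺l₁ at₂
       (FOL.caseA at mgu) =
  inference-properties O r₁≺l₁ at₂ at mgu (premises-⊙ ground₁)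
    (grounding-⊙ (lit ≈ l₁ r₁ ∷ C₁) σ₂ ground₁) (identity-⊙ (L₂ ∷ C₂) σ₂ σ₁-fixes-premise₂)
    (λ _ ⊨₂ → ⊨₂)
  where
    open FOL Fun arity
    open Rewriting Fun arity
    open DisjointPremises (lit ≈ l₁ r₁) C₁ σ₁ t₁ L₂ C₂ σ₂ t₂ disjoint
lemma3 Fun arity O l₁ r₁ C₁ σ₁ t₁ L₂ C₂ σ₂ t₂ p _ _ _ _ (ground₁ , _) (ground₂ , _) disjoint r₁≺l₁ at₂
       (FOL.caseB {δ = δ} {ρ = ρ} _ mgInst at mgu) =
  inference-properties O r₁≺l₁ at₂ at mgu (premises-⊙ ground₁)
    (grounding-⊙-⊙ (lit ≈ l₁ r₁ ∷ C₁) σ₂ ρ ground₁)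
    (mgInst-⊙ ground₂ mgInst) (λ I → models-⟪⟫c I δ)
  where
    open FOL Fun arity
    open Rewriting Fun arity
    open DisjointPremises (lit ≈ l₁ r₁) C₁ σ₁ t₁ L₂ C₂ σ₂ t₂ disjoint
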